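{- For all integers $L$ and $j$, \[ \sum_{\substack{r=0\\ r\equiv j \ (\mathrm{mod}\ 2)}}^{L} q^{\binom{L-r}{2}}\,(-q;q)_{L-r}\begin{bmatrix}L\\ r\end{bmatrix}_{q^2}\begin{bmatrix} r\\ \frac12(r-j)\end{bmatrix}_{q^2} = \begin{bmatrix}2L\\ L-j\end{bmatrix}_{q}. \]
   Context: For $n\ge 0$, $(a;q)_n=\prod_{i=0}^{n-1}(1-aq^i)$. The $q$-binomial coefficient is $\begin{bmatrix}L\\ a\end{bmatrix}_q=\frac{(q;q)_L}{(q;q)_a(q;q)_{L-a}}$ if $a\in\{0,1,\dots,L\}$ and $0$ otherwise. -}

module Defs where

open import Data.Nat as ℕ using (ℕ; zero; suc; _≤?_)
open import Data.Nat.Combinatorics using (_C_)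
open import Data.Integer as ℤ using (ℤ; +_; -[1+_])
open import Data.Rational using (ℚ; 0ℚ; 1ℚ; _+_; _*_; -_; 1/_; ≢-nonZero)
open import Data.Rational.Properties using (_≟_)
open import Data.List using (List; map; upTo; foldr)
open import Relation.Nullary using (yes; no)

-- total inverse on ℚ (convention 1/0 = 0); only ever applied to nonzero
-- denominators under the hypotheses of the theorem
inv : ℚ → ℚ
inv p with p ≟ 0ℚ
... | yes _ = 0ℚ
... | no p≢0 = 1/_ p {{≢-nonZero p≢0}}

pow : ℚ → ℕ → ℚ
pow q zero = 1ℚ
pow q (suc n) = q * pow q n

poch : ℚ → ℚ → ℕ → ℚ
poch a q zero = 1ℚ
poch a q (suc n) = poch a q n * (1ℚ + - (a * pow q n))

qbinomℕ : ℕ → ℕ → ℚ → ℚ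
qbinomℕ L a q with a ≤? L
... | yes _ = poch q q L * inv (poch q q a * poch q q (L ℕ.∸ a))
... | no _ = 0ℚ

qbinom : ℤ → ℤ → ℚ → ℚ
qbinom (+ L) (+ a) q = qbinomℕ L a q
qbinom (+ L) -[1+ a ] q = 0ℚ
qbinom -[1+ L ] a q = 0ℚ

sumTo : ℤ → (ℕ → ℚ) → ℚ
sumTo (+ n) f = foldr _+_ 0ℚ (map f (upTo (suc n)))
sumTo -[1+ n ] f = 0ℚ

summand : ℕ → ℤ → ℚ → ℕ → ℚ
summand n j q r with ((+ r) ℤ.- j) ℤ.% (+ 2)
... | suc _ = 0ℚ
... | zero =
  pow q ((n ℕ.∸ r) C 2) * poch (- q) q (n ℕ.∸ r)
    * qbinom (+ n) (+ r) (q * q)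
    * qbinom (+ r) (((+ r) ℤ.- j) ℤ./ (+ 2)) (q * q)

lhs : ℤ → ℤ → ℚ → ℚ
lhs (+ n) j q = sumTo (+ n) (summand n j q)
lhs -[1+ n ] j q = 0ℚ

-- Write F L for the left-hand side and G L = [2L, L - j]_q.  Both vanish for L < |j|, both
-- equal 1 at L = |j|, and for L ≥ |j| both satisfy the first-order recurrence
--   (1 - q^(L+1-j)) (1 - q^(L+1+j)) X (L + 1) = (1 - q^(2L+2)) (1 - q^(2L+1)) X L,
-- whose leading coefficient is nonzero because q ≠ ±1.  For G this is a ratio of
-- q-factorials.  For F it holds summand by summand: with r = a + b and j = b - a, the
-- summand t L r = q^C(L-r,2) (-q;q)_(L-r) [L,r]_(q²) [r,a]_(q²) satisfies
--   (1 - q^(L+1-j)) (1 - q^(L+1+j)) t (L+1) r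
--     = (1 - q^(2L+2)) ((q^(L-r) - q^(2L+1)) t L r + (1 - q^(L+2-r)) t L (r-2)),
-- which becomes a polynomial identity in q, q^(L-r), q^a, q^b once the (q²;q²)-factorials
-- are cleared.  Summing over r, the second parts add up to the sum of (1 - q^(L-r)) t L r,
-- so the coefficient of each t L r becomes 1 - q^(2L+1).

module Submission where

open import Defs
open import Function using (_∘_)
open import Data.Empty using (⊥; ⊥-elim)
open import Data.Product using (∃; ∃₂; _×_; _,_)
open import Data.Sum using (_⊎_; inj₁; inj₂)
open import Data.Fin using (toℕ; fromℕ; inject₁)
import Data.Fin.Properties as Finₚ
open import Data.List using (foldr; applyUpTo)
import Data.List.Properties as Listₚ
open import Data.Nat as ℕ using (ℕ; zero; suc; _≤_; _<_; _∸_; _≤?_; _<?_; z≤n)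
import Data.Nat.Properties as ℕₚ
open import Data.Nat.DivMod using (m*n%n≡0; m*n/n≡m; [m+kn]%n≡m%n)
open import Data.Nat.Combinatorics using (_C_; nCk+nC[k+1]≡[n+1]C[k+1]; nC1≡n)
open import Data.Integer as ℤ using (ℤ; +_; -[1+_])
import Data.Integer.Properties as ℤₚ
open import Data.Integer.Tactic.RingSolver using (solve-∀)
open import Data.Rational as ℚ using (ℚ; 0ℚ; 1ℚ; _+_; _*_; -_; _-_; ∣_∣; NonNegative; ≢-nonZero)
import Data.Rational.Properties as ℚₚ
open import Data.Rational.Solver using (module +-*-Solver)
open +-*-Solver using (solve; _:=_; _:+_; _:*_; _:-_; :-_; con)
open import Algebra.Bundles using (CommutativeMonoid; CommutativeRing)
open import Algebra.Properties.CommutativeSemigroup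
  (CommutativeMonoid.commutativeSemigroup ℚₚ.*-1-commutativeMonoid)
  using () renaming (interchange to *-interchange)
open import Algebra.Properties.Semiring.Sum (CommutativeRing.semiring ℚₚ.+-*-commutativeRing)
  using (sum-syntax; sum-cong-≗; ∑-distrib-+; *-distribˡ-sum; sum-init-last; sum-replicate-zero)
open import Relation.Binary.PropositionalEquality
open import Relation.Binary.Definitions using (tri<; tri≈; tri>)
open import Relation.Nullary using (¬_; yes; no; contradiction)

*-invʳ : ∀ {x} → x ≢ 0ℚ → x * inv x ≡ 1ℚ
*-invʳ {x} x≢0 with x ℚₚ.≟ 0ℚ
... | yes x≡0 = ⊥-elim (x≢0 x≡0)
... | no x≢0′ = ℚₚ.*-inverseʳ x {{≢-nonZero x≢0′}}

*-cancelʳ : ∀ {x y z} → x ≢ 0ℚ → y * x ≡ z * x → y ≡ z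
*-cancelʳ {x} {y} {z} x≢0 yx≡zx = begin
  y                ≡⟨ unit y ⟩
  y * x * inv x    ≡⟨ cong (_* inv x) yx≡zx ⟩
  z * x * inv x    ≡⟨ unit z ⟨
  z                ∎
  where
  open ≡-Reasoning
  unit : ∀ w → w ≡ w * x * inv x
  unit w = begin
    w                ≡⟨ ℚₚ.*-identityʳ w ⟨
    w * 1ℚ           ≡⟨ cong (w *_) (*-invʳ x≢0) ⟨
    w * (x * inv x)  ≡⟨ ℚₚ.*-assoc w x (inv x) ⟨
    w * x * inv x    ∎

*-cancelˡ : ∀ {x y z} → x ≢ 0ℚ → x * y ≡ x * z → y ≡ z
*-cancelˡ {x} {y} {z} x≢0 xy≡xz = *-cancelʳ x≢0 (trans (ℚₚ.*-comm y x) (trans xy≡xz (ℚₚ.*-comm x z)))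

*-≢0 : ∀ {x y} → x ≢ 0ℚ → y ≢ 0ℚ → x * y ≢ 0ℚ
*-≢0 {x} {y} x≢0 y≢0 xy≡0 =
  y≢0 (*-cancelʳ x≢0 (trans (ℚₚ.*-comm y x) (trans xy≡0 (sym (ℚₚ.*-zeroˡ x)))))

1-x≢0 : ∀ {x} → x ≢ 1ℚ → 1ℚ - x ≢ 0ℚ
1-x≢0 {x} x≢1 1-x≡0 = x≢1 (begin
  x                ≡⟨ solve 1 (λ x → x := con 1ℚ :- (con 1ℚ :- x)) refl x ⟩
  1ℚ - (1ℚ - x)    ≡⟨ cong (λ y → 1ℚ - y) 1-x≡0 ⟩
  1ℚ               ∎)
  where open ≡-Reasoning

pow-+ : ∀ x m n → pow x (m ℕ.+ n) ≡ pow x m * pow x n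
pow-+ x zero    n = sym (ℚₚ.*-identityˡ (pow x n))
pow-+ x (suc m) n = trans (cong (x *_) (pow-+ x m n)) (sym (ℚₚ.*-assoc x (pow x m) (pow x n)))

pow-+-+ : ∀ x k l n → pow x (k ℕ.+ (l ℕ.+ n)) ≡ pow x k * (pow x l * pow x n)
pow-+-+ x k l n = trans (pow-+ x k (l ℕ.+ n)) (cong (pow x k *_) (pow-+ x l n))

pow-* : ∀ x y n → pow (x * y) n ≡ pow x n * pow y n
pow-* x y zero    = refl
pow-* x y (suc n) = begin
  x * y * pow (x * y) n           ≡⟨ cong (x * y *_) (pow-* x y n) ⟩
  x * y * (pow x n * pow y n)     ≡⟨ *-interchange x y (pow x n) (pow y n) ⟩
  x * pow x n * (y * pow y n)     ∎
  where open ≡-Reasoning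

pow-∣∣ : ∀ x n → ∣ pow x n ∣ ≡ pow ∣ x ∣ n
pow-∣∣ x zero    = refl
pow-∣∣ x (suc n) = trans (ℚₚ.∣p*q∣≡∣p∣*∣q∣ x (pow x n)) (cong (∣ x ∣ *_) (pow-∣∣ x n))

module _ (t : ℚ) .{{_ : NonNegative t}} where

  pow-suc<1 : t ℚ.< 1ℚ → ∀ n → pow t (suc n) ℚ.< 1ℚ
  pow-suc<1 t<1 zero    = subst (ℚ._< 1ℚ) (sym (ℚₚ.*-identityʳ t)) t<1
  pow-suc<1 t<1 (suc n) = begin-strict
    t * pow t (suc n)  ≤⟨ ℚₚ.*-monoˡ-≤-nonNeg t (ℚₚ.<⇒≤ (pow-suc<1 t<1 n)) ⟩
    t * 1ℚ             ≡⟨ ℚₚ.*-identityʳ t ⟩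
    t                  <⟨ t<1 ⟩
    1ℚ                 ∎
    where open ℚₚ.≤-Reasoning

  pow-suc>1 : 1ℚ ℚ.< t → ∀ n → 1ℚ ℚ.< pow t (suc n)
  pow-suc>1 1<t zero    = subst (1ℚ ℚ.<_) (sym (ℚₚ.*-identityʳ t)) 1<t
  pow-suc>1 1<t (suc n) = begin-strict
    1ℚ                 <⟨ 1<t ⟩
    t                  ≡⟨ ℚₚ.*-identityʳ t ⟨
    t * 1ℚ             ≤⟨ ℚₚ.*-monoˡ-≤-nonNeg t (ℚₚ.<⇒≤ (pow-suc>1 1<t n)) ⟩
    t * pow t (suc n)  ∎
    where open ℚₚ.≤-Reasoning

  pow-suc≡1⇒≡1 : ∀ n → pow t (suc n) ≡ 1ℚ → t ≡ 1ℚ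
  pow-suc≡1⇒≡1 n tⁿ⁺¹≡1 with ℚₚ.<-cmp t 1ℚ
  ... | tri< t<1 _ _ = contradiction tⁿ⁺¹≡1 (ℚₚ.<⇒≢ (pow-suc<1 t<1 n))
  ... | tri≈ _ t≡1 _ = t≡1
  ... | tri> _ _ t>1 = contradiction (sym tⁿ⁺¹≡1) (ℚₚ.<⇒≢ (pow-suc>1 t>1 n))

pow-suc≢1 : ∀ {q} → q ≢ 1ℚ → q ≢ - 1ℚ → ∀ n → pow q (suc n) ≢ 1ℚ
pow-suc≢1 {q} q≢1 q≢-1 n qⁿ⁺¹≡1 = ±q≢1 (ℚₚ.∣p∣≡p∨∣p∣≡-p q)
  where
  ∣q∣≡1 : ∣ q ∣ ≡ 1ℚ
  ∣q∣≡1 = pow-suc≡1⇒≡1 ∣ q ∣ {{ℚₚ.∣-∣-nonNeg q}} n (trans (sym (pow-∣∣ q (suc n))) (cong ∣_∣ qⁿ⁺¹≡1))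
  ±q≢1 : ∣ q ∣ ≡ q ⊎ ∣ q ∣ ≡ - q → ⊥
  ±q≢1 (inj₁ ∣q∣≡q)  = q≢1 (trans (sym ∣q∣≡q) ∣q∣≡1)
  ±q≢1 (inj₂ ∣q∣≡-q) = q≢-1 (ℚₚ.neg-injective (trans (sym ∣q∣≡-q) ∣q∣≡1))

foldr-+-applyUpTo : ∀ n (f : ℕ → ℚ) → foldr _+_ 0ℚ (applyUpTo f n) ≡ ∑[ i < n ] f (toℕ i)
foldr-+-applyUpTo zero    f = refl
foldr-+-applyUpTo (suc n) f = cong (λ y → f 0 + y) (foldr-+-applyUpTo n (λ i → f (suc i)))

sumTo≡∑ : ∀ n f → sumTo (ℤ.+ n) f ≡ ∑[ i < suc n ] f (toℕ i)
sumTo≡∑ n f = trans (cong (foldr _+_ 0ℚ) (Listₚ.map-upTo f (suc n))) (foldr-+-applyUpTo (suc n) f)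

∑-vanishing : ∀ n (f : ℕ → ℚ) → (∀ i → i < n → f i ≡ 0ℚ) → ∑[ i < n ] f (toℕ i) ≡ 0ℚ
∑-vanishing n f fᵢ≡0 = trans (sum-cong-≗ {n} (λ i → fᵢ≡0 (toℕ i) (Finₚ.toℕ<n i))) (sum-replicate-zero n)

∑-last : ∀ n (f : ℕ → ℚ) → ∑[ i < suc n ] f (toℕ i) ≡ ∑[ i < n ] f (toℕ i) + f n
∑-last n f = begin
  ∑[ i < suc n ] f (toℕ i)                              ≡⟨ sum-init-last {n} (λ i → f (toℕ i)) ⟩
  ∑[ i < n ] f (toℕ (inject₁ i)) + f (toℕ (fromℕ n))   ≡⟨ cong₂ _+_ (sum-cong-≗ {n} (λ i → cong f (Finₚ.toℕ-inject₁ i)))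
                                                                   (cong f (Finₚ.toℕ-fromℕ n)) ⟩
  ∑[ i < n ] f (toℕ i) + f n                            ∎
  where open ≡-Reasoning

∑-last-vanishing : ∀ n (f : ℕ → ℚ) → f n ≡ 0ℚ → ∑[ i < suc n ] f (toℕ i) ≡ ∑[ i < n ] f (toℕ i)
∑-last-vanishing n f fₙ≡0 = begin
  ∑[ i < suc n ] f (toℕ i)    ≡⟨ ∑-last n f ⟩
  ∑[ i < n ] f (toℕ i) + f n  ≡⟨ cong (λ x → ∑[ i < n ] f (toℕ i) + x) fₙ≡0 ⟩
  ∑[ i < n ] f (toℕ i) + 0ℚ   ≡⟨ ℚₚ.+-identityʳ (∑[ i < n ] f (toℕ i)) ⟩
  ∑[ i < n ] f (toℕ i)        ∎
  where open ≡-Reasoning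

qbinomℕ-out : ∀ {n k} x → n < k → qbinomℕ n k x ≡ 0ℚ
qbinomℕ-out {n} {k} x n<k with k ≤? n
... | yes k≤n = contradiction k≤n (ℕₚ.<⇒≱ n<k)
... | no _    = refl

module QFactorial (x : ℚ) (xⁿ⁺¹≢1 : ∀ n → pow x (suc n) ≢ 1ℚ) where

  fac : ℕ → ℚ
  fac = poch x x

  fac≢0 : ∀ n → fac n ≢ 0ℚ
  fac≢0 zero    ()
  fac≢0 (suc n) = *-≢0 (fac≢0 n) (1-x≢0 (xⁿ⁺¹≢1 n))

  qbinomℕ-fac : ∀ {n k} → k ≤ n → qbinomℕ n k x * (fac k * fac (n ∸ k)) ≡ fac n
  qbinomℕ-fac {n} {k} k≤n with k ≤? n
  ... | no k≰n = contradiction k≤n k≰n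
  ... | yes _  = begin
    fac n * inv D * D    ≡⟨ ℚₚ.*-assoc (fac n) (inv D) D ⟩
    fac n * (inv D * D)  ≡⟨ cong (fac n *_) (trans (ℚₚ.*-comm (inv D) D) (*-invʳ D≢0)) ⟩
    fac n * 1ℚ           ≡⟨ ℚₚ.*-identityʳ (fac n) ⟩
    fac n                ∎
    where
    open ≡-Reasoning
    D = fac k * fac (n ∸ k)
    D≢0 = *-≢0 (fac≢0 k) (fac≢0 (n ∸ k))

  qbinomℕ-+-fac : ∀ a b → qbinomℕ (a ℕ.+ b) a x * (fac a * fac b) ≡ fac (a ℕ.+ b)
  qbinomℕ-+-fac a b = subst (λ c → qbinomℕ (a ℕ.+ b) a x * (fac a * fac c) ≡ fac (a ℕ.+ b))
    (ℕₚ.m+n∸m≡n a b) (qbinomℕ-fac (ℕₚ.m≤m+n a b))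

  qbinomℕ-0 : ∀ n → qbinomℕ n 0 x ≡ 1ℚ
  qbinomℕ-0 n = *-cancelʳ (fac≢0 n) (begin
    qbinomℕ n 0 x * fac n           ≡⟨ cong (qbinomℕ n 0 x *_) (ℚₚ.*-identityˡ (fac n)) ⟨
    qbinomℕ n 0 x * (1ℚ * fac n)    ≡⟨ qbinomℕ-fac {n} z≤n ⟩
    fac n                           ≡⟨ ℚₚ.*-identityˡ (fac n) ⟨
    1ℚ * fac n                      ∎)
    where open ≡-Reasoning

  qbinomℕ-diag : ∀ n → qbinomℕ n n x ≡ 1ℚ
  qbinomℕ-diag n = *-cancelʳ (fac≢0 n) (begin
    qbinomℕ n n x * fac n              ≡⟨ cong (qbinomℕ n n x *_) (ℚₚ.*-identityʳ (fac n)) ⟨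
    qbinomℕ n n x * (fac n * 1ℚ)       ≡⟨ cong (λ m → qbinomℕ n n x * (fac n * fac m)) (ℕₚ.n∸n≡0 n) ⟨
    qbinomℕ n n x * (fac n * fac (n ∸ n)) ≡⟨ qbinomℕ-fac {n} ℕₚ.≤-refl ⟩
    fac n                              ≡⟨ ℚₚ.*-identityˡ (fac n) ⟨
    1ℚ * fac n                         ∎)
    where open ≡-Reasoning

  qbinomℕ-suc : ∀ a b →
    (1ℚ - pow x (suc a)) * (1ℚ - pow x (suc b)) * qbinomℕ (suc a ℕ.+ suc b) (suc a) x
      ≡ (1ℚ - pow x (suc (suc (a ℕ.+ b)))) * (1ℚ - pow x (suc (a ℕ.+ b))) * qbinomℕ (a ℕ.+ b) a x
  qbinomℕ-suc a b = *-cancelʳ (*-≢0 (fac≢0 (suc a)) (fac≢0 (suc b))) (begin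
    gₐ * g_b * Q′ * (fac a * gₐ * (fac b * g_b))    ≡⟨ reorder gₐ g_b Q′ (fac a) (fac b) ⟩
    gₐ * g_b * (Q′ * (fac (suc a) * fac (suc b)))    ≡⟨ cong (gₐ * g_b *_) (qbinomℕ-+-fac (suc a) (suc b)) ⟩
    gₐ * g_b * fac (suc a ℕ.+ suc b)                 ≡⟨ cong (λ m → gₐ * g_b * fac (suc m)) (ℕₚ.+-suc a b) ⟩
    gₐ * g_b * (fac n * g₁ * g₂)                     ≡⟨ regroup gₐ g_b (fac n) g₁ g₂ ⟩
    g₂ * g₁ * (fac n * (gₐ * g_b))                   ≡⟨ cong (λ y → g₂ * g₁ * (y * (gₐ * g_b))) (qbinomℕ-+-fac a b) ⟨
    g₂ * g₁ * (Q * (fac a * fac b) * (gₐ * g_b))     ≡⟨ reorder′ g₂ g₁ Q (fac a) (fac b) gₐ g_b ⟩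
    g₂ * g₁ * Q * (fac a * gₐ * (fac b * g_b))       ∎)
    where
    open ≡-Reasoning
    n = a ℕ.+ b
    gₐ = 1ℚ - pow x (suc a)
    g_b = 1ℚ - pow x (suc b)
    g₁ = 1ℚ - pow x (suc n)
    g₂ = 1ℚ - pow x (suc (suc n))
    Q = qbinomℕ n a x
    Q′ = qbinomℕ (suc a ℕ.+ suc b) (suc a) x
    reorder : ∀ u v w y z → u * v * w * (y * u * (z * v)) ≡ u * v * (w * (y * u * (z * v)))
    reorder = solve 5 (λ u v w y z → u :* v :* w :* (y :* u :* (z :* v)) := u :* v :* (w :* (y :* u :* (z :* v)))) refl
    regroup : ∀ u v f s t → u * v * (f * s * t) ≡ t * s * (f * (u * v))
    regroup = solve 5 (λ u v f s t → u :* v :* (f :* s :* t) := t :* s :* (f :* (u :* v))) refl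
    reorder′ : ∀ s t Q y z u v → s * t * (Q * (y * z) * (u * v)) ≡ s * t * Q * (y * u * (z * v))
    reorder′ = solve 7 (λ s t Q y z u v → s :* t :* (Q :* (y :* z) :* (u :* v)) := s :* t :* Q :* (y :* u :* (z :* v))) refl

[1+m]C2≡m+mC2 : ∀ m → suc m C 2 ≡ m ℕ.+ m C 2
[1+m]C2≡m+mC2 m = trans (sym (nCk+nC[k+1]≡[n+1]C[k+1] m 1)) (cong (ℕ._+ m C 2) (nC1≡n m))

module Terms (q : ℚ) (q≢1 : q ≢ 1ℚ) (q≢-1 : q ≢ - 1ℚ) where

  p : ℚ
  p = q * q

  pⁿ⁺¹≢1 : ∀ n → pow p (suc n) ≢ 1ℚ
  pⁿ⁺¹≢1 n = pow-suc≢1 q≢1 q≢-1 (n ℕ.+ suc n) ∘ trans (trans (pow-+ q (suc n) (suc n)) (sym (pow-* q q (suc n))))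

  open QFactorial p pⁿ⁺¹≢1 public

  weight : ℕ → ℚ
  weight m = pow q (m C 2) * poch (- q) q m

  weight-suc : ∀ m → weight (suc m) ≡ weight m * (pow q m * (1ℚ + q * pow q m))
  weight-suc m = begin
    pow q (suc m C 2) * (P * (1ℚ + - (- q * X)))   ≡⟨ cong (λ e → pow q e * (P * (1ℚ + - (- q * X)))) ([1+m]C2≡m+mC2 m) ⟩
    pow q (m ℕ.+ m C 2) * (P * (1ℚ + - (- q * X))) ≡⟨ cong (_* (P * (1ℚ + - (- q * X)))) (pow-+ q m (m C 2)) ⟩
    X * Q * (P * (1ℚ + - (- q * X)))               ≡⟨ solve 4 (λ q X Q P → X :* Q :* (P :* (con 1ℚ :+ :- (:- q :* X)))
                                                                         := Q :* P :* (X :* (con 1ℚ :+ q :* X))) refl q X Q P ⟩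
    Q * P * (X * (1ℚ + q * X))                     ∎
    where
    open ≡-Reasoning
    X = pow q m
    Q = pow q (m C 2)
    P = poch (- q) q m

  term : ℕ → ℕ → ℕ → ℚ
  term n r a = weight (n ∸ r) * qbinomℕ n r p * qbinomℕ r a p

  term-fac : ∀ m a b → term (m ℕ.+ (a ℕ.+ b)) (a ℕ.+ b) a * (fac m * fac a * fac b) ≡ weight m * fac (m ℕ.+ (a ℕ.+ b))
  term-fac m a b = begin
    weight (L ∸ r) * Qₗ * Qᵣ * (fac m * fac a * fac b)
      ≡⟨ cong (λ k → weight k * Qₗ * Qᵣ * (fac m * fac a * fac b)) (ℕₚ.m+n∸n≡m m r) ⟩
    weight m * Qₗ * Qᵣ * (fac m * fac a * fac b)
      ≡⟨ solve 6 (λ w Qₗ Qᵣ fₘ fₐ f_b → w :* Qₗ :* Qᵣ :* (fₘ :* fₐ :* f_b) := w :* (Qₗ :* (Qᵣ :* (fₐ :* f_b) :* fₘ)))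
           refl (weight m) Qₗ Qᵣ (fac m) (fac a) (fac b) ⟩
    weight m * (Qₗ * (Qᵣ * (fac a * fac b) * fac m))
      ≡⟨ cong (λ f → weight m * (Qₗ * (f * fac m))) (qbinomℕ-+-fac a b) ⟩
    weight m * (Qₗ * (fac r * fac m))
      ≡⟨ cong (λ k → weight m * (Qₗ * (fac r * fac k))) (ℕₚ.m+n∸n≡m m r) ⟨
    weight m * (Qₗ * (fac r * fac (L ∸ r)))
      ≡⟨ cong (weight m *_) (qbinomℕ-fac (ℕₚ.m≤n+m r m)) ⟩
    weight m * fac L ∎
    where
    open ≡-Reasoning
    r = a ℕ.+ b
    L = m ℕ.+ r
    Qₗ = qbinomℕ L r p
    Qᵣ = qbinomℕ r a p

  term-fac-at : ∀ {L} m a b → L ≡ m ℕ.+ (a ℕ.+ b) → term L (a ℕ.+ b) a * (fac m * fac a * fac b) ≡ weight m * fac L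
  term-fac-at m a b refl = term-fac m a b

  term-vanishes-n<r : ∀ {n r} a → n < r → term n r a ≡ 0ℚ
  term-vanishes-n<r {n} {r} a n<r = begin
    weight (n ∸ r) * qbinomℕ n r p * qbinomℕ r a p  ≡⟨ cong (λ Q → weight (n ∸ r) * Q * qbinomℕ r a p) (qbinomℕ-out p n<r) ⟩
    weight (n ∸ r) * 0ℚ * qbinomℕ r a p             ≡⟨ cong (_* qbinomℕ r a p) (ℚₚ.*-zeroʳ (weight (n ∸ r))) ⟩
    0ℚ * qbinomℕ r a p                              ≡⟨ ℚₚ.*-zeroˡ (qbinomℕ r a p) ⟩
    0ℚ                                              ∎
    where open ≡-Reasoning

  term-vanishes-r<a : ∀ n {r a} → r < a → term n r a ≡ 0ℚ
  term-vanishes-r<a n {r} {a} r<a =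
    trans (cong (weight (n ∸ r) * qbinomℕ n r p *_) (qbinomℕ-out p r<a)) (ℚₚ.*-zeroʳ (weight (n ∸ r) * qbinomℕ n r p))

  term-mirror : ∀ n r → term n r r ≡ term n r 0
  term-mirror n r = cong (weight (n ∸ r) * qbinomℕ n r p *_) (trans (qbinomℕ-diag r) (sym (qbinomℕ-0 r)))

  term-diag : ∀ n → term n n 0 ≡ 1ℚ
  term-diag n = begin
    weight (n ∸ n) * qbinomℕ n n p * qbinomℕ n 0 p  ≡⟨ cong (λ k → weight k * qbinomℕ n n p * qbinomℕ n 0 p) (ℕₚ.n∸n≡0 n) ⟩
    1ℚ * 1ℚ * qbinomℕ n n p * qbinomℕ n 0 p         ≡⟨ cong₂ (λ x y → 1ℚ * 1ℚ * x * y) (qbinomℕ-diag n) (qbinomℕ-0 n) ⟩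
    1ℚ                                              ∎
    where open ≡-Reasoning

  1-q^ : ℕ → ℚ
  1-q^ n = 1ℚ - pow q n

  -- The truncated subtractions in α and β only bite where the summands they multiply vanish.
  α : ℕ → ℕ → ℚ
  α L r = pow q (L ∸ r) - pow q (suc (L ℕ.+ L))

  β : ℕ → ℕ → ℚ
  β L r = 1-q^ (suc (suc L) ∸ r)

  pull-factor-out : ∀ A t f g fa fb → A * t * (f * g * fa * fb) ≡ A * (t * (f * fa * fb)) * g
  pull-factor-out = solve 6 (λ A t f g fa fb → A :* t :* (f :* g :* fa :* fb) := A :* (t :* (f :* fa :* fb)) :* g) refl

  -- In the identity lemmas X, Y, Z stand for q^m, q^a, q^b, and w, F for weight m and fac L.
  -- The hypotheses express the powers and weights occurring in the step lemmas through them,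
  -- which turns each step into a polynomial identity.
  interior-identity : ∀ {X Y Z w F u v W pL k t x₀ x₂ pm pa pb w₁ w₂} →
    u ≡ q * (X * (q * Y * (q * Y))) → v ≡ q * (X * (q * Z * (q * Z))) →
    W ≡ X * (q * Y * (q * Z)) → pL ≡ W * W → k ≡ q * (q * (W * W)) → t ≡ q * (W * W) →
    x₀ ≡ X → x₂ ≡ q * (q * X) → pm ≡ X * X → pa ≡ Y * Y → pb ≡ Z * Z →
    w₁ ≡ w * (X * (1ℚ + q * X)) → w₂ ≡ w₁ * (q * X * (1ℚ + q * (q * X))) →
    (1ℚ - u) * (1ℚ - v) * (w₁ * (F * (1ℚ + - (p * pL)))) * (1ℚ + - (p * (p * pm)))
      ≡ (1ℚ - k) * ((x₀ - t) * (w * F) * ((1ℚ + - (p * pm)) * (1ℚ + - (p * (p * pm))))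
                   + (1ℚ - x₂) * (w₂ * F) * ((1ℚ + - (p * pa)) * (1ℚ + - (p * pb))))
  interior-identity {X} {Y} {Z} {w} {F} refl refl refl refl refl refl refl refl refl refl refl refl refl =
    solve 6 (λ q X Y Z w F →
      let p = q :* q ; W = X :* (q :* Y :* (q :* Z)) ; pm = X :* X ; w₁ = w :* (X :* (con 1ℚ :+ q :* X)) in
      (con 1ℚ :- q :* (X :* (q :* Y :* (q :* Y)))) :* (con 1ℚ :- q :* (X :* (q :* Z :* (q :* Z))))
        :* (w₁ :* (F :* (con 1ℚ :+ :- (p :* (W :* W))))) :* (con 1ℚ :+ :- (p :* (p :* pm)))
      := (con 1ℚ :- q :* (q :* (W :* W)))
           :* ((X :- q :* (W :* W)) :* (w :* F) :* ((con 1ℚ :+ :- (p :* pm)) :* (con 1ℚ :+ :- (p :* (p :* pm))))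
               :+ (con 1ℚ :- q :* (q :* X)) :* (w₁ :* (q :* X :* (con 1ℚ :+ q :* (q :* X))) :* F)
                  :* ((con 1ℚ :+ :- (p :* (Y :* Y))) :* (con 1ℚ :+ :- (p :* (Z :* Z))))))
      refl q X Y Z w F

  interior-step : ∀ m a b → let r = suc a ℕ.+ suc b ; L = m ℕ.+ r in
    1-q^ (suc m ℕ.+ (suc a ℕ.+ suc a)) * 1-q^ (suc m ℕ.+ (suc b ℕ.+ suc b)) * term (suc L) r (suc a)
      ≡ 1-q^ (suc (suc (L ℕ.+ L))) * (α L r * term L r (suc a) + β L r * term L (a ℕ.+ b) a)
  interior-step m a b = *-cancelʳ D≢0 (begin
    A * term (suc L) r a₁ * D
      ≡⟨ pull-factor-out A (term (suc L) r a₁) (fac (suc m)) g (fac a₁) (fac b₁) ⟩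
    A * (term (suc L) r a₁ * (fac (suc m) * fac a₁ * fac b₁)) * g
      ≡⟨ cong (λ e → A * e * g) (term-fac (suc m) a₁ b₁) ⟩
    A * (weight (suc m) * fac (suc L)) * g
      ≡⟨ interior-identity {w = weight m}
           (cong (q *_) (pow-+-+ q m a₁ a₁)) (cong (q *_) (pow-+-+ q m b₁ b₁))
           (pow-+-+ q m a₁ b₁) (pow-* q q L)
           (cong (λ e → q * (q * e)) (pow-+ q L L)) (cong (q *_) (pow-+ q L L))
           (cong (pow q) (ℕₚ.m+n∸n≡m m r)) (cong (pow q) (ℕₚ.m+n∸n≡m (suc (suc m)) r))
           (pow-* q q m) (pow-* q q a) (pow-* q q b)
           (weight-suc m) (weight-suc (suc m)) ⟩
    K * (α L r * (weight m * fac L) * (g₀ * g) + β L r * (weight (suc (suc m)) * fac L) * (hₐ * h_b))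
      ≡⟨ cong₂ (λ e e′ → K * (α L r * e * (g₀ * g) + β L r * e′ * (hₐ * h_b)))
           (term-fac m a₁ b₁) (term-fac-at (suc (suc m)) a b L≡m+2+[a+b]) ⟨
    K * (α L r * (t * (fac m * fac a₁ * fac b₁)) * (g₀ * g)
         + β L r * (t₂ * (fac (suc (suc m)) * fac a * fac b)) * (hₐ * h_b))
      ≡⟨ clear-rhs K (α L r) (β L r) t t₂ (fac m) g₀ g (fac a) hₐ (fac b) h_b ⟩
    K * (α L r * t + β L r * t₂) * D ∎)
    where
    open ≡-Reasoning
    a₁ = suc a
    b₁ = suc b
    r = a₁ ℕ.+ b₁
    L = m ℕ.+ r
    A = 1-q^ (suc m ℕ.+ (a₁ ℕ.+ a₁)) * 1-q^ (suc m ℕ.+ (b₁ ℕ.+ b₁))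
    K = 1-q^ (suc (suc (L ℕ.+ L)))
    t = term L r a₁
    t₂ = term L (a ℕ.+ b) a
    g₀ = 1ℚ + - (p * pow p m)
    g = 1ℚ + - (p * pow p (suc m))
    hₐ = 1ℚ + - (p * pow p a)
    h_b = 1ℚ + - (p * pow p b)
    D = fac (suc (suc m)) * fac a₁ * fac b₁
    D≢0 = *-≢0 (*-≢0 (fac≢0 (suc (suc m))) (fac≢0 a₁)) (fac≢0 b₁)
    L≡m+2+[a+b] : L ≡ suc (suc m) ℕ.+ (a ℕ.+ b)
    L≡m+2+[a+b] = trans (cong (λ k → m ℕ.+ suc k) (ℕₚ.+-suc a b))
                    (trans (ℕₚ.+-suc m (suc (a ℕ.+ b))) (cong suc (ℕₚ.+-suc m (a ℕ.+ b))))
    clear-rhs : ∀ K α β t t₂ fm g₀ g fa hₐ fb h_b →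
      K * (α * (t * (fm * (fa * hₐ) * (fb * h_b))) * (g₀ * g) + β * (t₂ * (fm * g₀ * g * fa * fb)) * (hₐ * h_b))
        ≡ K * (α * t + β * t₂) * (fm * g₀ * g * (fa * hₐ) * (fb * h_b))
    clear-rhs = solve 12 (λ K α β t t₂ fm g₀ g fa hₐ fb h_b →
      K :* (α :* (t :* (fm :* (fa :* hₐ) :* (fb :* h_b))) :* (g₀ :* g)
            :+ β :* (t₂ :* (fm :* g₀ :* g :* fa :* fb)) :* (hₐ :* h_b))
        := K :* (α :* t :+ β :* t₂) :* (fm :* g₀ :* g :* (fa :* hₐ) :* (fb :* h_b))) refl

  edge-identity : ∀ {X Z w F u v W pL k t x₀ pm w₁} →
    u ≡ q * X → v ≡ q * (X * (Z * Z)) → W ≡ X * Z → pL ≡ W * W → k ≡ q * (q * (W * W)) → t ≡ q * (W * W) →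
    x₀ ≡ X → pm ≡ X * X → w₁ ≡ w * (X * (1ℚ + q * X)) →
    (1ℚ - u) * (1ℚ - v) * (w₁ * (F * (1ℚ + - (p * pL)))) ≡ (1ℚ - k) * ((x₀ - t) * (w * F) * (1ℚ + - (p * pm)))
  edge-identity {X} {Z} {w} {F} refl refl refl refl refl refl refl refl refl =
    solve 5 (λ q X Z w F →
      let p = q :* q ; W = X :* Z in
      (con 1ℚ :- q :* X) :* (con 1ℚ :- q :* (X :* (Z :* Z)))
        :* (w :* (X :* (con 1ℚ :+ q :* X)) :* (F :* (con 1ℚ :+ :- (p :* (W :* W)))))
      := (con 1ℚ :- q :* (q :* (W :* W))) :* ((X :- q :* (W :* W)) :* (w :* F) :* (con 1ℚ :+ :- (p :* (X :* X)))))
      refl q X Z w F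

  edge-step : ∀ m b → let L = m ℕ.+ b in
    1-q^ (suc m) * 1-q^ (suc m ℕ.+ (b ℕ.+ b)) * term (suc L) b 0
      ≡ 1-q^ (suc (suc (L ℕ.+ L))) * (α L b * term L b 0 + β L b * 0ℚ)
  edge-step m b = *-cancelʳ D≢0 (begin
    A * term (suc L) b 0 * D                  ≡⟨ ℚₚ.*-assoc A (term (suc L) b 0) D ⟩
    A * (term (suc L) b 0 * D)                ≡⟨ cong (A *_) (term-fac (suc m) 0 b) ⟩
    A * (weight (suc m) * fac (suc L))        ≡⟨ edge-identity {w = weight m}
                                                   refl (cong (q *_) (pow-+-+ q m b b)) (pow-+ q m b) (pow-* q q L)
                                                   (cong (λ e → q * (q * e)) (pow-+ q L L)) (cong (q *_) (pow-+ q L L))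
                                                   (cong (pow q) (ℕₚ.m+n∸n≡m m b)) (pow-* q q m) (weight-suc m) ⟩
    K * (α L b * (weight m * fac L) * g₀)     ≡⟨ cong (λ e → K * (α L b * e * g₀)) (term-fac m 0 b) ⟨
    K * (α L b * (t * (fac m * fac 0 * fac b)) * g₀)
                                              ≡⟨ clear-rhs K (α L b) (β L b) t (fac m) g₀ (fac 0) (fac b) ⟩
    K * (α L b * t + β L b * 0ℚ) * D          ∎)
    where
    open ≡-Reasoning
    L = m ℕ.+ b
    A = 1-q^ (suc m) * 1-q^ (suc m ℕ.+ (b ℕ.+ b))
    K = 1-q^ (suc (suc (L ℕ.+ L)))
    t = term L b 0
    g₀ = 1ℚ + - (p * pow p m)
    D = fac (suc m) * fac 0 * fac b
    D≢0 = *-≢0 (*-≢0 (fac≢0 (suc m)) (fac≢0 0)) (fac≢0 b)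
    clear-rhs : ∀ K α β t fm g₀ f₀ fb →
      K * (α * (t * (fm * f₀ * fb)) * g₀) ≡ K * (α * t + β * 0ℚ) * (fm * g₀ * f₀ * fb)
    clear-rhs = solve 8 (λ K α β t fm g₀ f₀ fb →
      K :* (α :* (t :* (fm :* f₀ :* fb)) :* g₀) := K :* (α :* t :+ β :* con 0ℚ) :* (fm :* g₀ :* f₀ :* fb)) refl

  top-identity : ∀ {Y Z F u v W pL k x₂ pa pb} →
    u ≡ q * (Y * (q * Y)) → v ≡ q * (Z * (q * Z)) → W ≡ Y * (q * Z) → pL ≡ W * W → k ≡ q * (q * (W * W)) →
    x₂ ≡ q * 1ℚ → pa ≡ Y * Y → pb ≡ Z * Z →
    (1ℚ - u) * (1ℚ - v) * (weight 0 * (F * (1ℚ + - (p * pL)))) * (1ℚ + - (p * 1ℚ))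
      ≡ (1ℚ - k) * ((1ℚ - x₂) * (weight 1 * F) * ((1ℚ + - (p * pa)) * (1ℚ + - (p * pb))))
  top-identity {Y} {Z} {F} refl refl refl refl refl refl refl refl =
    solve 4 (λ q Y Z F →
      let p = q :* q ; W = Y :* (q :* Z) in
      (con 1ℚ :- q :* (Y :* (q :* Y))) :* (con 1ℚ :- q :* (Z :* (q :* Z)))
        :* (con 1ℚ :* con 1ℚ :* (F :* (con 1ℚ :+ :- (p :* (W :* W))))) :* (con 1ℚ :+ :- (p :* con 1ℚ))
      := (con 1ℚ :- q :* (q :* (W :* W)))
           :* ((con 1ℚ :- q :* con 1ℚ) :* (con 1ℚ :* (con 1ℚ :* (con 1ℚ :+ :- (:- q :* con 1ℚ))) :* F)
               :* ((con 1ℚ :+ :- (p :* (Y :* Y))) :* (con 1ℚ :+ :- (p :* (Z :* Z))))))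
      refl q Y Z F

  top-step : ∀ a b → let L = a ℕ.+ suc b ; r = suc L in
    1-q^ (suc a ℕ.+ suc a) * 1-q^ (suc b ℕ.+ suc b) * term r r (suc a)
      ≡ 1-q^ (suc (suc (L ℕ.+ L))) * (α L r * term L r (suc a) + β L r * term L (a ℕ.+ b) a)
  top-step a b = *-cancelʳ D≢0 (begin
    A * term r r a₁ * D
      ≡⟨ pull-factor-out A (term r r a₁) (fac 0) g₁ (fac a₁) (fac b₁) ⟩
    A * (term r r a₁ * (fac 0 * fac a₁ * fac b₁)) * g₁
      ≡⟨ cong (λ e → A * e * g₁) (term-fac 0 a₁ b₁) ⟩
    A * (weight 0 * fac r) * g₁
      ≡⟨ top-identity {Y = pow q a} {Z = pow q b}
           (cong (q *_) (pow-+ q a a₁)) (cong (q *_) (pow-+ q b b₁)) (pow-+ q a b₁) (pow-* q q L)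
           (cong (λ e → q * (q * e)) (pow-+ q L L)) (cong (pow q) (ℕₚ.m+n∸n≡m 1 L)) (pow-* q q a) (pow-* q q b) ⟩
    K * (β L r * (weight 1 * fac L) * (hₐ * h_b))
      ≡⟨ cong (λ e → K * (β L r * e * (hₐ * h_b))) (term-fac-at 1 a b (ℕₚ.+-suc a b)) ⟨
    K * (β L r * (t₂ * (fac 1 * fac a * fac b)) * (hₐ * h_b))
      ≡⟨ clear-rhs K (α L r) (β L r) t₂ (fac 1) (fac a) hₐ (fac b) h_b ⟩
    K * (α L r * 0ℚ + β L r * t₂) * D
      ≡⟨ cong (λ e → K * (α L r * e + β L r * t₂) * D) (term-vanishes-n<r a₁ (ℕₚ.n<1+n L)) ⟨
    K * (α L r * term L r a₁ + β L r * t₂) * D ∎)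
    where
    open ≡-Reasoning
    a₁ = suc a
    b₁ = suc b
    L = a ℕ.+ b₁
    r = suc L
    A = 1-q^ (a₁ ℕ.+ a₁) * 1-q^ (b₁ ℕ.+ b₁)
    K = 1-q^ (suc (suc (L ℕ.+ L)))
    t₂ = term L (a ℕ.+ b) a
    g₁ = 1ℚ + - (p * 1ℚ)
    hₐ = 1ℚ + - (p * pow p a)
    h_b = 1ℚ + - (p * pow p b)
    D = fac 1 * fac a₁ * fac b₁
    D≢0 = *-≢0 (*-≢0 (fac≢0 1) (fac≢0 a₁)) (fac≢0 b₁)
    clear-rhs : ∀ K α β t₂ f₁ fa hₐ fb h_b →
      K * (β * (t₂ * (f₁ * fa * fb)) * (hₐ * h_b)) ≡ K * (α * 0ℚ + β * t₂) * (f₁ * (fa * hₐ) * (fb * h_b))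
    clear-rhs = solve 9 (λ K α β t₂ f₁ fa hₐ fb h_b →
      K :* (β :* (t₂ :* (f₁ :* fa :* fb)) :* (hₐ :* h_b))
        := K :* (α :* con 0ℚ :+ β :* t₂) :* (f₁ :* (fa :* hₐ) :* (fb :* h_b))) refl

  mirrored-edge-step : ∀ m a → let r = a ℕ.+ 0 ; L = m ℕ.+ r in
    1-q^ (suc m ℕ.+ (a ℕ.+ a)) * 1-q^ (suc m) * term (suc L) r a
      ≡ 1-q^ (suc (suc (L ℕ.+ L))) * (α L r * term L r a + β L r * 0ℚ)
  mirrored-edge-step m a rewrite ℕₚ.+-identityʳ a = begin
    1-q^ (suc m ℕ.+ (a ℕ.+ a)) * 1-q^ (suc m) * term (suc L) a a
      ≡⟨ cong₂ _*_ (ℚₚ.*-comm (1-q^ (suc m ℕ.+ (a ℕ.+ a))) (1-q^ (suc m))) (term-mirror (suc L) a) ⟩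
    1-q^ (suc m) * 1-q^ (suc m ℕ.+ (a ℕ.+ a)) * term (suc L) a 0
      ≡⟨ edge-step m a ⟩
    1-q^ (suc (suc (L ℕ.+ L))) * (α L a * term L a 0 + β L a * 0ℚ)
      ≡⟨ cong (λ t → 1-q^ (suc (suc (L ℕ.+ L))) * (α L a * t + β L a * 0ℚ)) (term-mirror L a) ⟨
    1-q^ (suc (suc (L ℕ.+ L))) * (α L a * term L a a + β L a * 0ℚ) ∎
    where
    open ≡-Reasoning
    L = m ℕ.+ a

double≡*2 : ∀ a → a ℕ.+ a ≡ a ℕ.* 2
double≡*2 a = trans (cong (a ℕ.+_) (sym (ℕₚ.*-identityʳ a))) (sym (ℕₚ.*-suc a 1))

double%2 : ∀ a → (a ℕ.+ a) ℕ.% 2 ≡ 0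
double%2 a = trans (cong (ℕ._% 2) (double≡*2 a)) (m*n%n≡0 a 2)

double/2 : ∀ a → (a ℕ.+ a) ℕ./ 2 ≡ a
double/2 a = trans (cong (ℕ._/ 2) (double≡*2 a)) (m*n/n≡m a 2)

suc-double%2 : ∀ a → suc (a ℕ.+ a) ℕ.% 2 ≡ 1
suc-double%2 a = trans (cong (λ n → suc n ℕ.% 2) (double≡*2 a)) ([m+kn]%n≡m%n 1 a 2)

double-injective : ∀ {a b} → a ℕ.+ a ≡ b ℕ.+ b → a ≡ b
double-injective {a} {b} e = trans (sym (double/2 a)) (trans (cong (ℕ._/ 2) e) (double/2 b))

double≢suc-double : ∀ a b → a ℕ.+ a ≢ suc (b ℕ.+ b)
double≢suc-double a b e = 0≢1 (trans (sym (double%2 a)) (trans (cong (ℕ._% 2) e) (suc-double%2 b)))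
  where 0≢1 : 0 ≢ 1
        0≢1 ()

half : ∀ n → (∃ λ a → n ≡ a ℕ.+ a) ⊎ (∃ λ a → n ≡ suc (a ℕ.+ a))
half zero = inj₁ (0 , refl)
half (suc n) with half n
... | inj₁ (a , n≡a+a)   = inj₂ (a , cong suc n≡a+a)
... | inj₂ (a , n≡1+a+a) = inj₁ (suc a , cong suc (trans n≡1+a+a (sym (ℕₚ.+-suc a a))))

data Parity (z : ℤ) : Set where
  even⁺ : ∀ a → z ≡ + (a ℕ.+ a) → Parity z
  odd⁺  : ∀ a → z ≡ + suc (a ℕ.+ a) → Parity z
  odd⁻  : ∀ c → z ≡ -[1+ c ℕ.+ c ] → Parity z
  even⁻ : ∀ c → z ≡ -[1+ suc (c ℕ.+ c) ] → Parity z

parity : ∀ z → Parity z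
parity (+ n) with half n
... | inj₁ (a , e) = even⁺ a (cong +_ e)
... | inj₂ (a , e) = odd⁺ a (cong +_ e)
parity -[1+ n ] with half n
... | inj₁ (c , e) = odd⁻ c (cong -[1+_] e)
... | inj₂ (c , e) = even⁻ c (cong -[1+_] e)

pos-+-+ : ∀ k l m → + (k ℕ.+ (l ℕ.+ m)) ≡ + k ℤ.+ (+ l ℤ.+ + m)
pos-+-+ k l m = trans (ℤₚ.pos-+ k (l ℕ.+ m)) (cong (λ i → + k ℤ.+ i) (ℤₚ.pos-+ l m))

n+[a+b]-[b-a]≡n+[a+a] : ∀ n a b → + (n ℕ.+ (a ℕ.+ b)) ℤ.- (+ b ℤ.- + a) ≡ + (n ℕ.+ (a ℕ.+ a))
n+[a+b]-[b-a]≡n+[a+a] n a b = begin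
  + (n ℕ.+ (a ℕ.+ b)) ℤ.- (+ b ℤ.- + a)       ≡⟨ cong (ℤ._- (+ b ℤ.- + a)) (pos-+-+ n a b) ⟩
  + n ℤ.+ (+ a ℤ.+ + b) ℤ.- (+ b ℤ.- + a)    ≡⟨ shuffle (+ n) (+ a) (+ b) ⟩
  + n ℤ.+ (+ a ℤ.+ + a)                       ≡⟨ pos-+-+ n a a ⟨
  + (n ℕ.+ (a ℕ.+ a))                         ∎
  where
  open ≡-Reasoning
  shuffle : ∀ n a b → n ℤ.+ (a ℤ.+ b) ℤ.- (b ℤ.- a) ≡ n ℤ.+ (a ℤ.+ a)
  shuffle = solve-∀

n+[a+b]+[b-a]≡n+[b+b] : ∀ n a b → + (n ℕ.+ (a ℕ.+ b)) ℤ.+ (+ b ℤ.- + a) ≡ + (n ℕ.+ (b ℕ.+ b))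
n+[a+b]+[b-a]≡n+[b+b] n a b = begin
  + (n ℕ.+ (a ℕ.+ b)) ℤ.+ (+ b ℤ.- + a)      ≡⟨ cong (ℤ._+ (+ b ℤ.- + a)) (pos-+-+ n a b) ⟩
  + n ℤ.+ (+ a ℤ.+ + b) ℤ.+ (+ b ℤ.- + a)   ≡⟨ shuffle (+ n) (+ a) (+ b) ⟩
  + n ℤ.+ (+ b ℤ.+ + b)                      ≡⟨ pos-+-+ n b b ⟨
  + (n ℕ.+ (b ℕ.+ b))                        ∎
  where
  open ≡-Reasoning
  shuffle : ∀ n a b → n ℤ.+ (a ℤ.+ b) ℤ.+ (b ℤ.- a) ≡ n ℤ.+ (b ℤ.+ b)
  shuffle = solve-∀

+double/2 : ∀ a → + (a ℕ.+ a) ℤ./ + 2 ≡ + a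
+double/2 a = trans (ℤₚ.*-identityˡ (+ ((a ℕ.+ a) ℕ./ 2))) (cong +_ (double/2 a))

suc-suc-double : ∀ c → suc (suc (c ℕ.+ c)) ≡ suc c ℕ.+ suc c
suc-suc-double c = cong suc (sym (ℕₚ.+-suc c c))

suc-suc-double%2 : ∀ c → suc (suc (c ℕ.+ c)) ℕ.% 2 ≡ 0
suc-suc-double%2 c = trans (cong (ℕ._% 2) (suc-suc-double c)) (double%2 (suc c))

-double/2 : ∀ c → -[1+ suc (c ℕ.+ c) ] ℤ./ + 2 ≡ -[1+ c ]
-double/2 c rewrite suc-suc-double%2 c
                  | trans (cong (ℕ._/ 2) (suc-suc-double c)) (double/2 (suc c))
                  | ℕₚ.+-identityʳ c = refl

+≢-[1+] : ∀ {m n} → + m ≢ -[1+ n ]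
+≢-[1+] ()

b-a≡[1+b]-[1+a] : ∀ a b → + b ℤ.- + a ≡ + suc b ℤ.- + suc a
b-a≡[1+b]-[1+a] a b = shift (+ a) (+ b)
  where
  shift : ∀ a b → b ℤ.- a ≡ (+ 1 ℤ.+ b) ℤ.- (+ 1 ℤ.+ a)
  shift = solve-∀

r-j≡a+a⇒j≡b-a : ∀ r j a b → r ≡ a ℕ.+ b → + r ℤ.- j ≡ + (a ℕ.+ a) → j ≡ + b ℤ.- + a
r-j≡a+a⇒j≡b-a .(a ℕ.+ b) j a b refl e = begin
  j                                     ≡⟨ involution (+ (a ℕ.+ b)) j ⟩
  + (a ℕ.+ b) ℤ.- (+ (a ℕ.+ b) ℤ.- j)  ≡⟨ cong (λ i → + (a ℕ.+ b) ℤ.- i) e ⟩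
  + (a ℕ.+ b) ℤ.- + (a ℕ.+ a)          ≡⟨ cong₂ ℤ._-_ (ℤₚ.pos-+ a b) (ℤₚ.pos-+ a a) ⟩
  (+ a ℤ.+ + b) ℤ.- (+ a ℤ.+ + a)      ≡⟨ cancel (+ a) (+ b) ⟩
  + b ℤ.- + a                           ∎
  where
  open ≡-Reasoning
  involution : ∀ r j → j ≡ r ℤ.- (r ℤ.- j)
  involution = solve-∀
  cancel : ∀ a b → (a ℤ.+ b) ℤ.- (a ℤ.+ a) ≡ b ℤ.- a
  cancel = solve-∀

extremal-split : ∀ j → ∃₂ λ a₀ b₀ → j ≡ + b₀ ℤ.- + a₀ × (a₀ ≡ 0 ⊎ b₀ ≡ 0)
extremal-split (+ k)     = 0 , k , sym (ℤₚ.+-identityʳ (+ k)) , inj₁ refl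
extremal-split -[1+ k ]  = suc k , 0 , refl , inj₂ refl

data Position (L r : ℕ) : Set where
  inside : ∀ m → L ≡ m ℕ.+ r → Position L r
  top    : suc L ≡ r → Position L r
  beyond : suc L < r → Position L r

position : ∀ L r → Position L r
position L r with r ≤? L
... | yes r≤L = inside (L ∸ r) (sym (ℕₚ.m∸n+n≡m r≤L))
... | no r≰L with suc L ℕ.≟ r
...   | yes 1+L≡r = top 1+L≡r
...   | no 1+L≢r  = beyond (ℕₚ.≤∧≢⇒< (ℕₚ.≰⇒> r≰L) 1+L≢r)

module Identity (q : ℚ) (q≢1 : q ≢ 1ℚ) (q≢-1 : q ≢ - 1ℚ) (j : ℤ) where

  open Terms q q≢1 q≢-1
  module Gauss = QFactorial q (pow-suc≢1 q≢1 q≢-1)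

  s : ℕ → ℕ → ℚ
  s L = summand L j q

  s₋₂ : ℕ → ℕ → ℚ
  s₋₂ L zero          = 0ℚ
  s₋₂ L (suc zero)    = 0ℚ
  s₋₂ L (suc (suc r)) = s L r

  summand-even⁺ : ∀ {L r} a → + r ℤ.- j ≡ + (a ℕ.+ a) → s L r ≡ term L r a
  summand-even⁺ {L} {r} a e rewrite e | double%2 a =
    cong (λ h → weight (L ∸ r) * qbinomℕ L r p * qbinom (+ r) h p) (trans (cong (ℤ._/ + 2) e) (+double/2 a))

  summand-odd⁺ : ∀ {L r} a → + r ℤ.- j ≡ + suc (a ℕ.+ a) → s L r ≡ 0ℚ
  summand-odd⁺ a e rewrite e | suc-double%2 a = refl

  summand-odd⁻ : ∀ {L r} c → + r ℤ.- j ≡ -[1+ c ℕ.+ c ] → s L r ≡ 0ℚ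
  summand-odd⁻ c e rewrite e | suc-double%2 c = refl

  summand-even⁻ : ∀ {L r} c → + r ℤ.- j ≡ -[1+ suc (c ℕ.+ c) ] → s L r ≡ 0ℚ
  summand-even⁻ {L} {r} c e rewrite e | suc-suc-double%2 c = begin
    weight (L ∸ r) * qbinomℕ L r p * qbinom (+ r) ((+ r ℤ.- j) ℤ./ + 2) p
      ≡⟨ cong (λ h → weight (L ∸ r) * qbinomℕ L r p * qbinom (+ r) h p) (trans (cong (ℤ._/ + 2) e) (-double/2 c)) ⟩
    weight (L ∸ r) * qbinomℕ L r p * 0ℚ
      ≡⟨ ℚₚ.*-zeroʳ (weight (L ∸ r) * qbinomℕ L r p) ⟩
    0ℚ ∎
    where open ≡-Reasoning

  -- a = (r - j)/2 and b = (r + j)/2: the summand at r vanishes unless both are natural numbers.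
  Split : ℕ → Set
  Split r = ∃₂ λ a b → r ≡ a ℕ.+ b × j ≡ + b ℤ.- + a

  r-j≡a+a : ∀ {r} a b → r ≡ a ℕ.+ b → j ≡ + b ℤ.- + a → + r ℤ.- j ≡ + (a ℕ.+ a)
  r-j≡a+a a b refl refl = n+[a+b]-[b-a]≡n+[a+a] 0 a b

  summand-split : ∀ {L r} a b → r ≡ a ℕ.+ b → j ≡ + b ℤ.- + a → s L r ≡ term L r a
  summand-split a b r≡a+b j≡b-a = summand-even⁺ a (r-j≡a+a a b r≡a+b j≡b-a)

  split-unique : ∀ {r} a b a′ b′ → r ≡ a ℕ.+ b → j ≡ + b ℤ.- + a → r ≡ a′ ℕ.+ b′ → j ≡ + b′ ℤ.- + a′ →
                 a ≡ a′ × b ≡ b′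
  split-unique a b a′ b′ r≡a+b j≡b-a r≡a′+b′ j≡b′-a′ =
    a≡a′ , ℕₚ.+-cancelˡ-≡ a b b′ (trans (sym r≡a+b) (trans r≡a′+b′ (cong (ℕ._+ b′) (sym a≡a′))))
    where a≡a′ = double-injective (ℤₚ.+-injective (trans (sym (r-j≡a+a a b r≡a+b j≡b-a)) (r-j≡a+a a′ b′ r≡a′+b′ j≡b′-a′)))

  split-shift : ∀ {r} → Split r → Split (suc (suc r))
  split-shift (a , b , r≡a+b , j≡b-a) =
    suc a , suc b , cong suc (trans (cong suc r≡a+b) (sym (ℕₚ.+-suc a b))) , trans j≡b-a (b-a≡[1+b]-[1+a] a b)

  split-bound : ∀ {r} → Split r → ℤ.∣ j ∣ ≤ r
  split-bound (a , b , r≡a+b , j≡b-a) = begin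
    ℤ.∣ j ∣                   ≡⟨ cong ℤ.∣_∣ j≡b-a ⟩
    ℤ.∣ + b ℤ.- + a ∣         ≤⟨ ℤₚ.∣i-j∣≤∣i∣+∣j∣ (+ b) (+ a) ⟩
    b ℕ.+ a                   ≡⟨ ℕₚ.+-comm b a ⟩
    a ℕ.+ b                   ≡⟨ r≡a+b ⟨
    _                         ∎
    where open ℕₚ.≤-Reasoning

  r-j≢a+a⇒¬Split : ∀ {r} → (∀ a → + r ℤ.- j ≢ + (a ℕ.+ a)) → ¬ Split r
  r-j≢a+a⇒¬Split r-j≢a+a (a , b , r≡a+b , j≡b-a) = r-j≢a+a a (r-j≡a+a a b r≡a+b j≡b-a)

  splitting : ∀ r → Split r ⊎ (¬ Split r × (∀ L → s L r ≡ 0ℚ))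
  splitting r with parity (+ r ℤ.- j)
  ... | odd⁺ a e  = inj₂ (r-j≢a+a⇒¬Split (λ a′ e′ → double≢suc-double a′ a (ℤₚ.+-injective (trans (sym e′) e))) ,
                         λ L → summand-odd⁺ a e)
  ... | odd⁻ c e  = inj₂ (r-j≢a+a⇒¬Split (λ _ e′ → +≢-[1+] (trans (sym e′) e)) , λ L → summand-odd⁻ c e)
  ... | even⁻ c e = inj₂ (r-j≢a+a⇒¬Split (λ _ e′ → +≢-[1+] (trans (sym e′) e)) , λ L → summand-even⁻ c e)
  ... | even⁺ a e with a ≤? r
  ...   | yes a≤r = inj₁ (a , r ∸ a , r≡a+b , r-j≡a+a⇒j≡b-a r j a (r ∸ a) r≡a+b e)
    where r≡a+b = sym (ℕₚ.m+[n∸m]≡n a≤r)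
  ...   | no a≰r  = inj₂ (¬split , λ L → trans (summand-even⁺ a e) (term-vanishes-r<a L (ℕₚ.≰⇒> a≰r)))
    where
    ¬split : ¬ Split r
    ¬split (a′ , b′ , r≡a′+b′ , j≡b′-a′) =
      a≰r (subst (_≤ r) a′≡a (subst (a′ ≤_) (sym r≡a′+b′) (ℕₚ.m≤m+n a′ b′)))
      where a′≡a = double-injective (ℤₚ.+-injective (trans (sym (r-j≡a+a a′ b′ r≡a′+b′ j≡b′-a′)) e))

  s₋₂-vanishes : ∀ L r → (∀ {r′} → r ≡ suc (suc r′) → ¬ Split r′) → s₋₂ L r ≡ 0ℚ
  s₋₂-vanishes L zero          _      = refl
  s₋₂-vanishes L (suc zero)    _      = refl
  s₋₂-vanishes L (suc (suc r)) ¬split with splitting r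
  ... | inj₁ split          = contradiction split (¬split refl)
  ... | inj₂ (_ , vanishes) = vanishes L

  s₋₂-edge : ∀ L a b → j ≡ + b ℤ.- + a → a ≡ 0 ⊎ b ≡ 0 → s₋₂ L (a ℕ.+ b) ≡ 0ℚ
  s₋₂-edge L a b j≡b-a edge = s₋₂-vanishes L (a ℕ.+ b) λ r≡r′+2 split′ →
    let (a′ , b′ , r′+2≡a′+b′ , j≡b′-a′) = split-shift split′
    in not-interior edge (split-unique a b a′ b′ refl j≡b-a (trans r≡r′+2 r′+2≡a′+b′) j≡b′-a′)
    where
    not-interior : ∀ {a′ b′} → a ≡ 0 ⊎ b ≡ 0 → a ≡ suc a′ × b ≡ suc b′ → ⊥
    not-interior (inj₁ a≡0) (a≡1+a′ , _) = ℕₚ.1+n≢0 (trans (sym a≡1+a′) a≡0)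
    not-interior (inj₂ b≡0) (_ , b≡1+b′) = ℕₚ.1+n≢0 (trans (sym b≡1+b′) b≡0)

  s₋₂-interior : ∀ L a b → j ≡ + suc b ℤ.- + suc a → s₋₂ L (suc a ℕ.+ suc b) ≡ term L (a ℕ.+ b) a
  s₋₂-interior L a b j≡ =
    trans (cong (λ k → s₋₂ L (suc k)) (ℕₚ.+-suc a b)) (summand-split a b refl (trans j≡ (sym (b-a≡[1+b]-[1+a] a b))))

  1+u≡n+[a+a] : ∀ {L u} n a b → + u ≡ + L ℤ.- j → suc L ≡ n ℕ.+ (a ℕ.+ b) → j ≡ + b ℤ.- + a → suc u ≡ n ℕ.+ (a ℕ.+ a)
  1+u≡n+[a+a] {L} {u} n a b u≡L-j 1+L≡n+a+b j≡b-a = ℤₚ.+-injective (begin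
    + 1 ℤ.+ + u                         ≡⟨ cong (λ i → + 1 ℤ.+ i) u≡L-j ⟩
    + 1 ℤ.+ (+ L ℤ.- j)                 ≡⟨ ℤₚ.+-assoc (+ 1) (+ L) (ℤ.- j) ⟨
    + suc L ℤ.- j                       ≡⟨ cong₂ (λ k i → + k ℤ.- i) 1+L≡n+a+b j≡b-a ⟩
    + (n ℕ.+ (a ℕ.+ b)) ℤ.- (+ b ℤ.- + a) ≡⟨ n+[a+b]-[b-a]≡n+[a+a] n a b ⟩
    + (n ℕ.+ (a ℕ.+ a))                 ∎)
    where open ≡-Reasoning

  1+v≡n+[b+b] : ∀ {L v} n a b → + v ≡ + L ℤ.+ j → suc L ≡ n ℕ.+ (a ℕ.+ b) → j ≡ + b ℤ.- + a → suc v ≡ n ℕ.+ (b ℕ.+ b)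
  1+v≡n+[b+b] {L} {v} n a b v≡L+j 1+L≡n+a+b j≡b-a = ℤₚ.+-injective (begin
    + 1 ℤ.+ + v                         ≡⟨ cong (λ i → + 1 ℤ.+ i) v≡L+j ⟩
    + 1 ℤ.+ (+ L ℤ.+ j)                 ≡⟨ ℤₚ.+-assoc (+ 1) (+ L) j ⟨
    + suc L ℤ.+ j                       ≡⟨ cong₂ (λ k i → + k ℤ.+ i) 1+L≡n+a+b j≡b-a ⟩
    + (n ℕ.+ (a ℕ.+ b)) ℤ.+ (+ b ℤ.- + a) ≡⟨ n+[a+b]+[b-a]≡n+[b+b] n a b ⟩
    + (n ℕ.+ (b ℕ.+ b))                 ∎)
    where open ≡-Reasoning

  TermRecurrence : ℕ → ℕ → ℕ → ℕ → Set
  TermRecurrence L u v r =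
    1-q^ (suc u) * 1-q^ (suc v) * s (suc L) r ≡ 1-q^ (suc (suc (L ℕ.+ L))) * (α L r * s L r + β L r * s₋₂ L r)

  recurrence-from : ∀ {L u v r u′ v′ x₁ x₀ x₂} →
    suc u ≡ u′ → suc v ≡ v′ → s (suc L) r ≡ x₁ → s L r ≡ x₀ → s₋₂ L r ≡ x₂ →
    1-q^ u′ * 1-q^ v′ * x₁ ≡ 1-q^ (suc (suc (L ℕ.+ L))) * (α L r * x₀ + β L r * x₂) →
    TermRecurrence L u v r
  recurrence-from refl refl refl refl refl identity = identity

  vanishing-recurrence : ∀ {L u v r} → s (suc L) r ≡ 0ℚ → s L r ≡ 0ℚ → s₋₂ L r ≡ 0ℚ → TermRecurrence L u v r
  vanishing-recurrence {L} {u} {v} {r} e₁ e₀ e₂ = recurrence-from {L} {u} {v} {r} refl refl e₁ e₀ e₂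
    (solve 5 (λ A B K α β → A :* B :* con 0ℚ := K :* (α :* con 0ℚ :+ β :* con 0ℚ)) refl
      (1-q^ (suc u)) (1-q^ (suc v)) (1-q^ (suc (suc (L ℕ.+ L)))) (α L r) (β L r))

  beyond-recurrence : ∀ {L u v} a b → j ≡ + b ℤ.- + a → suc L < a ℕ.+ b → TermRecurrence L u v (a ℕ.+ b)
  beyond-recurrence {L} {u} {v} a b j≡b-a 1+L<r = recurrence-from {L} {u} {v} refl refl
    (trans (summand-split a b refl j≡b-a) (term-vanishes-n<r a 1+L<r))
    (trans (summand-split a b refl j≡b-a) (term-vanishes-n<r a (ℕₚ.<-trans (ℕₚ.n<1+n L) 1+L<r)))
    refl
    (begin
      1-q^ (suc u) * 1-q^ (suc v) * 0ℚ
        ≡⟨ solve 5 (λ A B K α x → A :* B :* con 0ℚ := K :* (α :* con 0ℚ :+ (con 1ℚ :- con 1ℚ) :* x)) refl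
             (1-q^ (suc u)) (1-q^ (suc v)) K (α L r) (s₋₂ L r) ⟩
      K * (α L r * 0ℚ + 1-q^ 0 * s₋₂ L r)
        ≡⟨ cong (λ k → K * (α L r * 0ℚ + 1-q^ k * s₋₂ L r)) (ℕₚ.m≤n⇒m∸n≡0 1+L<r) ⟨
      K * (α L r * 0ℚ + β L r * s₋₂ L r) ∎)
    where
    open ≡-Reasoning
    r = a ℕ.+ b
    K = 1-q^ (suc (suc (L ℕ.+ L)))

  inside-recurrence : ∀ m {u v} a b → let L = m ℕ.+ (a ℕ.+ b) in
    + u ≡ + L ℤ.- j → + v ≡ + L ℤ.+ j → j ≡ + b ℤ.- + a → TermRecurrence L u v (a ℕ.+ b)
  inside-recurrence m (suc a) (suc b) u≡ v≡ j≡ = recurrence-from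
    (1+u≡n+[a+a] (suc m) (suc a) (suc b) u≡ refl j≡) (1+v≡n+[b+b] (suc m) (suc a) (suc b) v≡ refl j≡)
    (summand-split (suc a) (suc b) refl j≡) (summand-split (suc a) (suc b) refl j≡) (s₋₂-interior _ a b j≡)
    (interior-step m a b)
  inside-recurrence m zero b u≡ v≡ j≡ = recurrence-from
    (trans (1+u≡n+[a+a] (suc m) 0 b u≡ refl j≡) (cong suc (ℕₚ.+-identityʳ m))) (1+v≡n+[b+b] (suc m) 0 b v≡ refl j≡)
    (summand-split 0 b refl j≡) (summand-split 0 b refl j≡) (s₋₂-edge _ 0 b j≡ (inj₁ refl))
    (edge-step m b)
  inside-recurrence m (suc a) zero u≡ v≡ j≡ = recurrence-from
    (1+u≡n+[a+a] (suc m) (suc a) 0 u≡ refl j≡) (trans (1+v≡n+[b+b] (suc m) (suc a) 0 v≡ refl j≡) (cong suc (ℕₚ.+-identityʳ m)))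
    (summand-split (suc a) 0 refl j≡) (summand-split (suc a) 0 refl j≡) (s₋₂-edge _ (suc a) 0 j≡ (inj₂ refl))
    (mirrored-edge-step m (suc a))

  top-recurrence : ∀ {L u v} a b → + u ≡ + L ℤ.- j → + v ≡ + L ℤ.+ j → j ≡ + b ℤ.- + a →
    suc L ≡ a ℕ.+ b → TermRecurrence L u v (a ℕ.+ b)
  top-recurrence (suc a) (suc b) u≡ v≡ j≡ refl = recurrence-from
    (1+u≡n+[a+a] 0 (suc a) (suc b) u≡ refl j≡) (1+v≡n+[b+b] 0 (suc a) (suc b) v≡ refl j≡)
    (summand-split (suc a) (suc b) refl j≡) (summand-split (suc a) (suc b) refl j≡) (s₋₂-interior _ a b j≡)
    (top-step a b)
  top-recurrence zero    b    u≡ v≡ j≡ 1+L≡r = ⊥-elim (ℕₚ.1+n≢0 (1+u≡n+[a+a] 0 0 b u≡ 1+L≡r j≡))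
  top-recurrence (suc a) zero u≡ v≡ j≡ 1+L≡r = ⊥-elim (ℕₚ.1+n≢0 (1+v≡n+[b+b] 0 (suc a) 0 v≡ 1+L≡r j≡))

  term-recurrence : ∀ L {u v} → + u ≡ + L ℤ.- j → + v ≡ + L ℤ.+ j → ∀ r → TermRecurrence L u v r
  term-recurrence L {u} {v} u≡ v≡ r with splitting r
  ... | inj₂ (¬split , vanishes) =
    vanishing-recurrence {u = u} {v} (vanishes (suc L)) (vanishes L)
      (s₋₂-vanishes L r λ r≡r′+2 → ¬split ∘ subst Split (sym r≡r′+2) ∘ split-shift)
  ... | inj₁ (a , b , refl , j≡) with position L (a ℕ.+ b)
  ...   | inside m refl = inside-recurrence m a b u≡ v≡ j≡
  ...   | top 1+L≡r     = top-recurrence a b u≡ v≡ j≡ 1+L≡r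
  ...   | beyond 1+L<r  = beyond-recurrence {u = u} {v} a b j≡ 1+L<r

  F : ℕ → ℚ
  F L = ∑[ r < suc L ] s L (toℕ r)

  G : ℕ → ℚ
  G n = qbinom (+ (n ℕ.+ n)) (+ n ℤ.- j) q

  s-unsplit : ∀ {L r} → ¬ Split r → s L r ≡ 0ℚ
  s-unsplit {L} {r} ¬split with splitting r
  ... | inj₁ split          = contradiction split ¬split
  ... | inj₂ (_ , vanishes) = vanishes L

  s-beyond : ∀ {L r} → L < r → s L r ≡ 0ℚ
  s-beyond {L} {r} L<r with splitting r
  ... | inj₁ (a , b , r≡a+b , j≡b-a) = trans (summand-split a b r≡a+b j≡b-a) (term-vanishes-n<r a L<r)
  ... | inj₂ (_ , vanishes)          = vanishes L

  α-sum-drop-last : ∀ L → ∑[ r < suc (suc L) ] (α L (toℕ r) * s L (toℕ r)) ≡ ∑[ r < suc L ] (α L (toℕ r) * s L (toℕ r))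
  α-sum-drop-last L = ∑-last-vanishing (suc L) (λ r → α L r * s L r)
    (trans (cong (α L (suc L) *_) (s-beyond (ℕₚ.n<1+n L))) (ℚₚ.*-zeroʳ (α L (suc L))))

  -- β L (2 + r) is 1 - q^(L ∸ r), so the β-sum is a shifted sum over the same summands.
  β-sum-shift : ∀ L →
    ∑[ r < suc (suc L) ] (β L (toℕ r) * s₋₂ L (toℕ r)) ≡ ∑[ r < suc L ] (1-q^ (L ∸ toℕ r) * s L (toℕ r))
  β-sum-shift L = begin
    β L 0 * 0ℚ + (β L 1 * 0ℚ + ∑[ r < L ] (1-q^ (L ∸ toℕ r) * s L (toℕ r)))
      ≡⟨ solve 3 (λ x y z → x :* con 0ℚ :+ (y :* con 0ℚ :+ z) := z) refl (β L 0) (β L 1) _ ⟩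
    ∑[ r < L ] (1-q^ (L ∸ toℕ r) * s L (toℕ r))
      ≡⟨ ∑-last-vanishing L (λ r → 1-q^ (L ∸ r) * s L r) last-vanishes ⟨
    ∑[ r < suc L ] (1-q^ (L ∸ toℕ r) * s L (toℕ r)) ∎
    where
    open ≡-Reasoning
    last-vanishes : 1-q^ (L ∸ L) * s L L ≡ 0ℚ
    last-vanishes = trans (cong (λ k → 1-q^ k * s L L) (ℕₚ.n∸n≡0 L))
                      (solve 1 (λ x → (con 1ℚ :- con 1ℚ) :* x := con 0ℚ) refl (s L L))

  F-recurrence : ∀ L {u v} → + u ≡ + L ℤ.- j → + v ≡ + L ℤ.+ j →
    1-q^ (suc u) * 1-q^ (suc v) * F (suc L) ≡ 1-q^ (suc (suc (L ℕ.+ L))) * 1-q^ (suc (L ℕ.+ L)) * F L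
  F-recurrence L {u} {v} u≡ v≡ = begin
    A * ∑[ r < 2+L ] s (suc L) (toℕ r)
      ≡⟨ *-distribˡ-sum {2+L} A (λ r → s (suc L) (toℕ r)) ⟩
    ∑[ r < 2+L ] (A * s (suc L) (toℕ r))
      ≡⟨ sum-cong-≗ {2+L} (λ r → term-recurrence L u≡ v≡ (toℕ r)) ⟩
    ∑[ r < 2+L ] (K * (αs (toℕ r) + βs (toℕ r)))
      ≡⟨ *-distribˡ-sum {2+L} K (λ r → αs (toℕ r) + βs (toℕ r)) ⟨
    K * ∑[ r < 2+L ] (αs (toℕ r) + βs (toℕ r))
      ≡⟨ cong (K *_) (∑-distrib-+ {2+L} (αs ∘ toℕ) (βs ∘ toℕ)) ⟩
    K * (∑[ r < 2+L ] αs (toℕ r) + ∑[ r < 2+L ] βs (toℕ r))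
      ≡⟨ cong₂ (λ x y → K * (x + y)) (α-sum-drop-last L) (β-sum-shift L) ⟩
    K * (∑[ r < 1+L ] αs (toℕ r) + ∑[ r < 1+L ] γs (toℕ r))
      ≡⟨ cong (K *_) (∑-distrib-+ {1+L} (αs ∘ toℕ) (γs ∘ toℕ)) ⟨
    K * ∑[ r < 1+L ] (αs (toℕ r) + γs (toℕ r))
      ≡⟨ cong (K *_) (sum-cong-≗ {1+L} (λ r → coefficients-add (pow q (L ∸ toℕ r)) (pow q (suc (L ℕ.+ L))) (s L (toℕ r)))) ⟩
    K * ∑[ r < 1+L ] (1-q^ (suc (L ℕ.+ L)) * s L (toℕ r))
      ≡⟨ cong (K *_) (*-distribˡ-sum {1+L} (1-q^ (suc (L ℕ.+ L))) (λ r → s L (toℕ r))) ⟨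
    K * (1-q^ (suc (L ℕ.+ L)) * F L)
      ≡⟨ ℚₚ.*-assoc K (1-q^ (suc (L ℕ.+ L))) (F L) ⟨
    K * 1-q^ (suc (L ℕ.+ L)) * F L ∎
    where
    open ≡-Reasoning
    1+L = suc L
    2+L = suc (suc L)
    A = 1-q^ (suc u) * 1-q^ (suc v)
    K = 1-q^ (suc (suc (L ℕ.+ L)))
    αs βs γs : ℕ → ℚ
    αs r = α L r * s L r
    βs r = β L r * s₋₂ L r
    γs r = 1-q^ (L ∸ r) * s L r
    coefficients-add : ∀ x t y → (x - t) * y + (1ℚ - x) * y ≡ (1ℚ - t) * y
    coefficients-add = solve 3 (λ x t y → (x :- t) :* y :+ (con 1ℚ :- x) :* y := (con 1ℚ :- t) :* y) refl

  G-recurrence : ∀ n {u v} → + u ≡ + n ℤ.- j → + v ≡ + n ℤ.+ j →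
    1-q^ (suc u) * 1-q^ (suc v) * G (suc n) ≡ 1-q^ (suc (suc (n ℕ.+ n))) * 1-q^ (suc (n ℕ.+ n)) * G n
  G-recurrence n {u} {v} u≡ v≡ = begin
    A * G (suc n)
      ≡⟨ cong (A *_) (cong₂ (λ N k → qbinom (+ N) k q) 2+n+n≡1+u+1+v 1+n-j≡1+u) ⟩
    A * qbinomℕ (suc u ℕ.+ suc v) (suc u) q
      ≡⟨ Gauss.qbinomℕ-suc u v ⟩
    1-q^ (suc (suc (u ℕ.+ v))) * 1-q^ (suc (u ℕ.+ v)) * qbinomℕ (u ℕ.+ v) u q
      ≡⟨ cong (λ k → 1-q^ (suc (suc k)) * 1-q^ (suc k) * qbinomℕ k u q) u+v≡n+n ⟩
    1-q^ (suc (suc (n ℕ.+ n))) * 1-q^ (suc (n ℕ.+ n)) * qbinomℕ (n ℕ.+ n) u q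
      ≡⟨ cong (λ k → 1-q^ (suc (suc (n ℕ.+ n))) * 1-q^ (suc (n ℕ.+ n)) * qbinom (+ (n ℕ.+ n)) k q) u≡ ⟩
    1-q^ (suc (suc (n ℕ.+ n))) * 1-q^ (suc (n ℕ.+ n)) * G n ∎
    where
    open ≡-Reasoning
    A = 1-q^ (suc u) * 1-q^ (suc v)
    u+v≡n+n : u ℕ.+ v ≡ n ℕ.+ n
    u+v≡n+n = ℤₚ.+-injective (begin
      + (u ℕ.+ v)                       ≡⟨ ℤₚ.pos-+ u v ⟩
      + u ℤ.+ + v                       ≡⟨ cong₂ ℤ._+_ u≡ v≡ ⟩
      (+ n ℤ.- j) ℤ.+ (+ n ℤ.+ j)       ≡⟨ cancel (+ n) j ⟩
      + n ℤ.+ + n                       ≡⟨ ℤₚ.pos-+ n n ⟨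
      + (n ℕ.+ n)                       ∎)
      where
      cancel : ∀ n j → (n ℤ.- j) ℤ.+ (n ℤ.+ j) ≡ n ℤ.+ n
      cancel = solve-∀
    1+n-j≡1+u : + suc n ℤ.- j ≡ + suc u
    1+n-j≡1+u = trans (ℤₚ.+-assoc (+ 1) (+ n) (ℤ.- j)) (cong (λ i → + 1 ℤ.+ i) (sym u≡))
    2+n+n≡1+u+1+v : suc n ℕ.+ suc n ≡ suc u ℕ.+ suc v
    2+n+n≡1+u+1+v = cong suc (trans (ℕₚ.+-suc n n) (trans (cong suc (sym u+v≡n+n)) (sym (ℕₚ.+-suc u v))))

  -- The split of |j| itself: both sides vanish below a₀ + b₀ = |j| and equal 1 there.
  Extremal : ℕ → ℕ → Set
  Extremal a₀ b₀ = j ≡ + b₀ ℤ.- + a₀ × (a₀ ≡ 0 ⊎ b₀ ≡ 0)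

  ∣j∣≡a₀+b₀ : ∀ {a₀ b₀} → Extremal a₀ b₀ → ℤ.∣ j ∣ ≡ a₀ ℕ.+ b₀
  ∣j∣≡a₀+b₀ {b₀ = b₀} (j≡b₀-0 , inj₁ refl) = trans (cong ℤ.∣_∣ j≡b₀-0) (ℕₚ.+-identityʳ b₀)
  ∣j∣≡a₀+b₀ {a₀ = a₀} (j≡0-a₀ , inj₂ refl) = begin
    ℤ.∣ j ∣                    ≡⟨ cong ℤ.∣_∣ (trans j≡0-a₀ (ℤₚ.+-identityˡ (ℤ.- + a₀))) ⟩
    ℤ.∣ ℤ.- + a₀ ∣             ≡⟨ ℤₚ.∣-i∣≡∣i∣ (+ a₀) ⟩
    a₀                         ≡⟨ ℕₚ.+-identityʳ a₀ ⟨
    a₀ ℕ.+ 0                   ∎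
    where open ≡-Reasoning

  s-below : ∀ {a₀ b₀ L r} → Extremal a₀ b₀ → r < a₀ ℕ.+ b₀ → s L r ≡ 0ℚ
  s-below ext r<N = s-unsplit λ split → ℕₚ.<⇒≱ r<N (subst (_≤ _) (∣j∣≡a₀+b₀ ext) (split-bound split))

  F-below : ∀ {a₀ b₀ n} → Extremal a₀ b₀ → n < a₀ ℕ.+ b₀ → F n ≡ 0ℚ
  F-below {n = n} ext n<N = ∑-vanishing (suc n) (s n) (λ r r<1+n → s-below ext (ℕₚ.<-≤-trans r<1+n n<N))

  G-below : ∀ {a₀ b₀ n} → Extremal a₀ b₀ → n < a₀ ℕ.+ b₀ → G n ≡ 0ℚ
  G-below {n = n} (j≡b₀-0 , inj₁ refl) n<b₀ with ℕₚ.m≤n⇒∃[o]m+o≡n n<b₀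
  ... | k , refl = cong (λ i → qbinom (+ (n ℕ.+ n)) i q) (begin
    + n ℤ.- j                                 ≡⟨ cong (λ i → + n ℤ.- i) j≡b₀-0 ⟩
    + n ℤ.- (+ 1 ℤ.+ + (n ℕ.+ k) ℤ.- + 0)     ≡⟨ cong (λ i → + n ℤ.- (+ 1 ℤ.+ i ℤ.- + 0)) (ℤₚ.pos-+ n k) ⟩
    + n ℤ.- (+ 1 ℤ.+ (+ n ℤ.+ + k) ℤ.- + 0)   ≡⟨ negate (+ n) (+ k) ⟩
    -[1+ k ]                                  ∎)
    where
    open ≡-Reasoning
    negate : ∀ n k → n ℤ.- (+ 1 ℤ.+ (n ℤ.+ k) ℤ.- + 0) ≡ ℤ.- (+ 1 ℤ.+ k)
    negate = solve-∀
  G-below {a₀} {n = n} (j≡0-a₀ , inj₂ refl) n<a₀+0 = begin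
    qbinom (+ (n ℕ.+ n)) (+ n ℤ.- j) q  ≡⟨ cong (λ i → qbinom (+ (n ℕ.+ n)) i q) n-j≡n+a₀ ⟩
    qbinomℕ (n ℕ.+ n) (n ℕ.+ a₀) q      ≡⟨ qbinomℕ-out q (ℕₚ.+-monoʳ-< n (subst (n <_) (ℕₚ.+-identityʳ a₀) n<a₀+0)) ⟩
    0ℚ                                  ∎
    where
    open ≡-Reasoning
    n-j≡n+a₀ : + n ℤ.- j ≡ + (n ℕ.+ a₀)
    n-j≡n+a₀ = trans (cong (λ i → + n ℤ.- i) j≡0-a₀) (trans (double-negation (+ n) (+ a₀)) (sym (ℤₚ.pos-+ n a₀)))
      where
      double-negation : ∀ n a → n ℤ.- (+ 0 ℤ.- a) ≡ n ℤ.+ a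
      double-negation = solve-∀

  F-base : ∀ {a₀ b₀} → Extremal a₀ b₀ → F (a₀ ℕ.+ b₀) ≡ 1ℚ
  F-base {a₀} {b₀} ext@(j≡b₀-a₀ , _) = begin
    F N                                  ≡⟨ ∑-last N (s N) ⟩
    ∑[ r < N ] s N (toℕ r) + s N N        ≡⟨ cong₂ _+_ (∑-vanishing N (s N) (λ r → s-below ext))
                                                      (summand-split a₀ b₀ refl j≡b₀-a₀) ⟩
    0ℚ + term N N a₀                     ≡⟨ ℚₚ.+-identityˡ (term N N a₀) ⟩
    term N N a₀                          ≡⟨ diagonal ext ⟩
    1ℚ                                   ∎
    where
    open ≡-Reasoning
    N = a₀ ℕ.+ b₀
    diagonal : ∀ {a₀ b₀} → Extremal a₀ b₀ → term (a₀ ℕ.+ b₀) (a₀ ℕ.+ b₀) a₀ ≡ 1ℚ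
    diagonal {b₀ = b₀} (_ , inj₁ refl) = term-diag b₀
    diagonal {a₀ = a₀} (_ , inj₂ refl) rewrite ℕₚ.+-identityʳ a₀ = trans (term-mirror a₀ a₀) (term-diag a₀)

  G-base : ∀ {a₀ b₀} → Extremal a₀ b₀ → G (a₀ ℕ.+ b₀) ≡ 1ℚ
  G-base {a₀} {b₀} ext@(j≡b₀-a₀ , _) =
    trans (cong (λ k → qbinom (+ (N ℕ.+ N)) k q) (r-j≡a+a a₀ b₀ refl j≡b₀-a₀)) (diagonal ext)
    where
    N = a₀ ℕ.+ b₀
    diagonal : ∀ {a₀ b₀} → Extremal a₀ b₀ → qbinomℕ ((a₀ ℕ.+ b₀) ℕ.+ (a₀ ℕ.+ b₀)) (a₀ ℕ.+ a₀) q ≡ 1ℚ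
    diagonal {b₀ = b₀} (_ , inj₁ refl) = Gauss.qbinomℕ-0 (b₀ ℕ.+ b₀)
    diagonal {a₀ = a₀} (_ , inj₂ refl) rewrite ℕₚ.+-identityʳ a₀ = Gauss.qbinomℕ-diag (a₀ ℕ.+ a₀)

  F≡G-above : ∀ {a₀ b₀} → Extremal a₀ b₀ → ∀ d → F (d ℕ.+ (a₀ ℕ.+ b₀)) ≡ G (d ℕ.+ (a₀ ℕ.+ b₀))
  F≡G-above ext zero = trans (F-base ext) (sym (G-base ext))
  F≡G-above {a₀} {b₀} ext@(j≡b₀-a₀ , _) (suc d) = *-cancelˡ A≢0 (begin
    A * F (suc L)      ≡⟨ F-recurrence L u≡ v≡ ⟩
    R * F L            ≡⟨ cong (R *_) (F≡G-above ext d) ⟩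
    R * G L            ≡⟨ G-recurrence L u≡ v≡ ⟨
    A * G (suc L)      ∎)
    where
    open ≡-Reasoning
    L = d ℕ.+ (a₀ ℕ.+ b₀)
    R = 1-q^ (suc (suc (L ℕ.+ L))) * 1-q^ (suc (L ℕ.+ L))
    A = 1-q^ (suc (d ℕ.+ (a₀ ℕ.+ a₀))) * 1-q^ (suc (d ℕ.+ (b₀ ℕ.+ b₀)))
    A≢0 = *-≢0 (1-x≢0 (pow-suc≢1 q≢1 q≢-1 (d ℕ.+ (a₀ ℕ.+ a₀)))) (1-x≢0 (pow-suc≢1 q≢1 q≢-1 (d ℕ.+ (b₀ ℕ.+ b₀))))
    u≡ : + (d ℕ.+ (a₀ ℕ.+ a₀)) ≡ + L ℤ.- j
    u≡ = sym (trans (cong (λ i → + L ℤ.- i) j≡b₀-a₀) (n+[a+b]-[b-a]≡n+[a+a] d a₀ b₀))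
    v≡ : + (d ℕ.+ (b₀ ℕ.+ b₀)) ≡ + L ℤ.+ j
    v≡ = sym (trans (cong (λ i → + L ℤ.+ i) j≡b₀-a₀) (n+[a+b]+[b-a]≡n+[b+b] d a₀ b₀))

  F≡G : ∀ n → F n ≡ G n
  F≡G n with extremal-split j
  ... | a₀ , b₀ , ext with n <? a₀ ℕ.+ b₀
  ...   | yes n<N = trans (F-below ext n<N) (sym (G-below ext n<N))
  ...   | no n≮N  = subst (λ k → F k ≡ G k) (ℕₚ.m∸n+n≡m (ℕₚ.≮⇒≥ n≮N)) (F≡G-above ext (n ∸ (a₀ ℕ.+ b₀)))

corollary2p2 : (L j : ℤ) (q : ℚ) → q ≢ 1ℚ → q ≢ - 1ℚ →
    lhs L j q ≡ qbinom (L ℤ.+ L) (L ℤ.- j) q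
corollary2p2 (+ n)    j q q≢1 q≢-1 = trans (sumTo≡∑ n (summand n j q)) (Identity.F≡G q q≢1 q≢-1 j n)
corollary2p2 -[1+ n ] j q _   _    = refl
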